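{- Let $k$ be a nonnegative integer, let $G=(V,E)$ be a connected graph and let $X\subseteq V$ be such that $G[X]$ is connected and $\deg_G(x)\leq k+1$ for every $x\in X$. Then \[\gamma_{P,k}(G/X)-1\le \gamma_{P,k}(G)\leq \gamma_{P,k}(G/X)+1.\]
   Context: Graphs are finite, simple and undirected; $G[X]$ is the induced subgraph. For $X\subseteq V$, the contraction $G/X$ is the graph obtained from $G-X$ by adding a new vertex $v_X$ with $N_{G/X}(v_X)=N_G[X]\setminus X$. For a graph $G=(V,E)$, nonnegative integer $k$ and $S\subseteq V$, define $\mathscr P^0_{G,k}(S)=N[S]$ and $\mathscr P^{i+1}_{G,k}(S)=\mathscr P^i_{G,k}(S)\cup\bigcup\{N(v): v\in \mathscr P^i_{G,k}(S),\ 1\le |N(v)\setminus \mathscr P^i_{G,k}(S)|\le k\}$. $S$ is a $k$-power dominating set of $G$ if $\mathscr P^\ell_{G,k}(S)=V$ for some $\ell$; $\gamma_{P,k}(G)$ is the minimum size of such a set. -}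

module Defs where

open import Data.Nat using (ℕ; zero; suc; _≤_)
open import Data.Bool using (Bool; true; false)
open import Data.Unit using (⊤; tt)
open import Data.Empty using (⊥)
open import Data.Sum using (_⊎_; inj₁; inj₂)
open import Data.Product using (Σ; ∃; _×_; _,_)
open import Data.List using (List; length)
open import Data.List.Membership.Propositional using (_∈_)
open import Data.List.Relation.Unary.Unique.Propositional using (Unique)
open import Relation.Binary.PropositionalEquality using (_≡_)
open import Relation.Binary.Construct.Closure.ReflexiveTransitive using (Star)
open import Relation.Nullary using (¬_)

record Graph : Set₁ where
  field
    V   : Set
    Adj : V → V → Set
open Graph public

Finite : Graph → Set
Finite G = Σ (List (V G)) λ vs → ∀ v → v ∈ vs

Simple : Graph → Set
Simple G = (∀ u v → Adj G u v → Adj G v u) × (∀ v → ¬ Adj G v v)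

Connected : Graph → Set
Connected G = ∀ u v → Star (Adj G) u v

InducedConnected : (G : Graph) → (V G → Bool) → Set
InducedConnected G X =
  Σ (V G) (λ x → X x ≡ true) ×
  (∀ x y → X x ≡ true → X y ≡ true →
     Star (λ a b → X a ≡ true × X b ≡ true × Adj G a b) x y)

AtMost : {A : Set} → ℕ → (A → Set) → Set
AtMost {A} m P = Σ (List A) λ L → Unique L × length L ≤ m × (∀ u → P u → u ∈ L)

DegAtMost : (G : Graph) → V G → ℕ → Set
DegAtMost G x m = AtMost m (Adj G x)

-- Contraction G/X: vertices of G - X plus a new vertex v_X,
-- N(v_X) = N[X] \ X.
ContrAdj : (G : Graph) (X : V G → Bool) →
  (Σ (V G) (λ v → X v ≡ false) ⊎ ⊤) → (Σ (V G) (λ v → X v ≡ false) ⊎ ⊤) → Set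
ContrAdj G X (inj₁ (u , _)) (inj₁ (w , _)) = Adj G u w
ContrAdj G X (inj₁ (u , _)) (inj₂ _)       = Σ (V G) λ x → X x ≡ true × Adj G x u
ContrAdj G X (inj₂ _)       (inj₁ (w , _)) = Σ (V G) λ x → X x ≡ true × Adj G x w
ContrAdj G X (inj₂ _)       (inj₂ _)       = ⊥

_/_ : (G : Graph) → (V G → Bool) → Graph
G / X = record
  { V   = Σ (V G) (λ v → X v ≡ false) ⊎ ⊤
  ; Adj = ContrAdj G X }

ClosedNbhd : (G : Graph) → List (V G) → V G → Set
ClosedNbhd G S w = Σ (V G) λ s → s ∈ S × (s ≡ w ⊎ Adj G s w)

PowerStep : (G : Graph) (k : ℕ) (S : List (V G)) → ℕ → V G → Set
PowerStep G k S zero    w = ClosedNbhd G S w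
PowerStep G k S (suc i) w =
  PowerStep G k S i w ⊎
  Σ (V G) λ v →
    PowerStep G k S i v ×
    (Σ (V G) λ u → Adj G v u × ¬ PowerStep G k S i u) ×
    AtMost k (λ u → Adj G v u × ¬ PowerStep G k S i u) ×
    Adj G v w

IsKPDS : (G : Graph) (k : ℕ) → List (V G) → Set
IsKPDS G k S = Σ ℕ λ ℓ → ∀ w → PowerStep G k S ℓ w

IsPowerDomNumber : (G : Graph) (k : ℕ) → ℕ → Set
IsPowerDomNumber G k m =
  (Σ (List (V G)) λ S → Unique S × IsKPDS G k S × length S ≡ m) ×
  (∀ S → Unique S → IsKPDS G k S → m ≤ length S)

-- In G/X the new vertex v_X observes N(X) at once. So a k-power dominating set S of G gives
-- one of G/X by adding v_X and dropping the vertices of X: every propagation step of G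
-- outside X is replayed in G/X. Conversely, from a k-power dominating set of G/X take its
-- vertices other than v_X together with one vertex x₀ of X. As G[X] is connected and each
-- vertex of X has degree at most k + 1, propagation from x₀ along walks in X observes N[X]
-- (a vertex of X with one observed neighbour has at most k unobserved ones), after which the
-- propagation in G/X is replayed in G with a delay.
-- Observation is not decidable here, since adjacency is an arbitrary relation, so the
-- propagation arguments run in the double-negation monad; the final inequalities are
-- decidable and hence stable.
module Submission where

open import Defs
open import Level using (0ℓ)
open import Data.Nat using (ℕ; zero; suc; _≤_; _≤′_; ≤′-refl; ≤′-step; _+_; _⊔_; z≤n; s≤s; _≤?_)
open import Data.Nat.Properties
  using (≤-trans; ≤-pred; ≤-reflexive; +-comm; m≤m⊔n; m≤n⊔m; m≤n+m; ≤⇒≤′)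
open import Data.Bool using (Bool; true; false; _≟_)
open import Data.Bool.Properties using (¬-not)
open import Axiom.UniquenessOfIdentityProofs using (module Decidable⇒UIP)
open import Data.Product using (Σ; ∃; _×_; _,_; proj₁; proj₂)
open import Data.Sum using (_⊎_; inj₁; inj₂)
open import Data.Unit using (tt)
open import Data.Empty using (⊥-elim)
open import Data.Maybe using (Maybe; just; nothing)
open import Data.List using (List; []; _∷_; length; filter; mapMaybe)
open import Data.List.Properties using (length-mapMaybe; filter-notAll)
open import Data.List.Membership.Propositional using (_∈_)
open import Data.List.Membership.Propositional.Properties using (∈-filter⁺)
open import Data.List.Relation.Unary.Any as Any using (here; there)
open import Data.List.Relation.Unary.All as All using ()
open import Data.List.Relation.Unary.All.Properties using (¬Any⇒All¬)
open import Data.List.Relation.Unary.AllPairs using ([]; _∷_)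
open import Data.List.Relation.Unary.Unique.Propositional using (Unique)
open import Data.List.Relation.Unary.Unique.Propositional.Properties as Unique using ()
open import Effect.Monad using (RawMonad)
open import Relation.Binary.PropositionalEquality using (_≡_; _≢_; refl; sym; trans; cong)
open import Relation.Binary.Construct.Closure.ReflexiveTransitive using (Star; ε; _◅_)
open import Relation.Nullary using (¬_; Dec; yes; no; ¬?)
open import Relation.Nullary.Negation using (¬¬-Monad)
open import Relation.Nullary.Decidable using (decidable-stable; ¬¬-excluded-middle)
open import Relation.Unary using (Decidable)
open import Function using (_∘_; id)
open import Function.Bundles using (_⇔_; mk⇔; Equivalence)

open RawMonad (¬¬-Monad {0ℓ})

Listed : Set → Set
Listed A = Σ (List A) λ vs → ∀ v → v ∈ vs

¬¬-∀-listed : {A : Set} {P : A → Set} → Listed A → (∀ v → ¬ ¬ P v) → ¬ ¬ (∀ v → P v)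
¬¬-∀-listed (vs , ∈vs) ¬¬P = do
  Pvs ← All.sequenceM 0ℓ ¬¬-Monad (All.tabulate {xs = vs} λ {v} _ → ¬¬P v)
  return λ v → All.lookup Pvs (∈vs v)

¬¬-decidable-listed : {A : Set} {P : A → Set} → Listed A → ¬ ¬ Decidable P
¬¬-decidable-listed fin = ¬¬-∀-listed fin λ _ → ¬¬-excluded-middle

uniform-bound : {A : Set} {P : ℕ → A → Set} →
  (∀ {i j v} → i ≤ j → P i v → P j v) → Listed A →
  (∀ v → Σ ℕ λ r → P r v) → Σ ℕ λ R → ∀ v → P R v
uniform-bound {A} {P} mono (vs , ∈vs) bound =
  let R , PR = bounded-on vs in R , λ v → PR v (∈vs v)
  where
  bounded-on : (us : List A) → Σ ℕ λ R → ∀ v → v ∈ us → P R v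
  bounded-on [] = 0 , λ _ ()
  bounded-on (u ∷ us) with r , Pr ← bound u | R , PR ← bounded-on us =
    r ⊔ R , λ { v (here refl)   → mono (m≤m⊔n r R) Pr
              ; v (there v∈us) → mono (m≤n⊔m r R) (PR v v∈us) }

PartialInjective : {A B : Set} → (A → Maybe B) → Set
PartialInjective f = ∀ {a a′ b} → f a ≡ just b → f a′ ≡ just b → a ≡ a′

module _ {A B : Set} (f : A → Maybe B) where

  ∈-mapMaybe⁺ : ∀ {a b xs} → a ∈ xs → f a ≡ just b → b ∈ mapMaybe f xs
  ∈-mapMaybe⁺ {xs = x ∷ xs} (here refl) fa≡b with f x
  ∈-mapMaybe⁺ {xs = x ∷ xs} (here refl) refl | just b = here refl
  ∈-mapMaybe⁺ {xs = x ∷ xs} (there a∈xs) fa≡b with f x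
  ... | just _  = there (∈-mapMaybe⁺ a∈xs fa≡b)
  ... | nothing = ∈-mapMaybe⁺ a∈xs fa≡b

  ∈-mapMaybe⁻ : ∀ {b} xs → b ∈ mapMaybe f xs → ∃ λ a → a ∈ xs × f a ≡ just b
  ∈-mapMaybe⁻ (x ∷ xs) b∈ with f x in fx
  ∈-mapMaybe⁻ (x ∷ xs) (here refl) | just _ = x , here refl , fx
  ∈-mapMaybe⁻ (x ∷ xs) (there b∈) | just _ with a , a∈ , fa ← ∈-mapMaybe⁻ xs b∈ = a , there a∈ , fa
  ∈-mapMaybe⁻ (x ∷ xs) b∈ | nothing with a , a∈ , fa ← ∈-mapMaybe⁻ xs b∈ = a , there a∈ , fa

  mapMaybe-unique : PartialInjective f → ∀ {xs} → Unique xs → Unique (mapMaybe f xs)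
  mapMaybe-unique inj {[]} [] = []
  mapMaybe-unique inj {x ∷ xs} (x∉xs ∷ uxs) with f x in fx
  ... | nothing = mapMaybe-unique inj uxs
  ... | just b  = All.tabulate b∉ ∷ mapMaybe-unique inj uxs
    where
    b∉ : ∀ {c} → c ∈ mapMaybe f xs → b ≢ c
    b∉ c∈ refl with a , a∈ , fa ← ∈-mapMaybe⁻ xs c∈ = All.lookup x∉xs a∈ (inj fx fa)

  ∷-mapMaybe-unique : PartialInjective f → ∀ {b xs} → (∀ a → f a ≢ just b) → Unique xs →
    Unique (b ∷ mapMaybe f xs)
  ∷-mapMaybe-unique inj {b} {xs} b∉img xs-unique =
    ¬Any⇒All¬ _ (λ b∈ → let a , _ , fa≡b = ∈-mapMaybe⁻ xs b∈ in b∉img a fa≡b) ∷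
    mapMaybe-unique inj xs-unique

  length-∷-mapMaybe : ∀ b xs → length (b ∷ mapMaybe f xs) ≤ length xs + 1
  length-∷-mapMaybe _ xs = ≤-trans (s≤s (length-mapMaybe f xs)) (≤-reflexive (+-comm 1 (length xs)))

module _ {A : Set} {P Q : A → Set} where

  atMost-filter : ∀ {k a} → Decidable Q → AtMost (suc k) P → P a → ¬ Q a →
    AtMost k (λ u → P u × Q u)
  atMost-filter Q? (us , us-unique , |us|≤ , P⊆us) Pa ¬Qa =
    filter Q? us ,
    Unique.filter⁺ Q? us-unique ,
    ≤-pred (≤-trans (filter-notAll Q? us (Any.map (λ { refl → ¬Qa }) (P⊆us _ Pa))) |us|≤) ,
    λ u (Pu , Qu) → ∈-filter⁺ Q? (P⊆us u Pu) Qu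

module _ {A B : Set} {P : A → Set} {Q : B → Set} {f : A → Maybe B} where

  atMost-mapMaybe : ∀ {k} → PartialInjective f → AtMost k P →
    (∀ b → Q b → ∃ λ a → P a × f a ≡ just b) → AtMost k Q
  atMost-mapMaybe inj (as , as-unique , |as|≤ , P⊆as) Q⊆fP =
    mapMaybe f as ,
    mapMaybe-unique f inj as-unique ,
    ≤-trans (length-mapMaybe f as) |as|≤ ,
    λ b Qb → let a , Pa , fa≡b = Q⊆fP b Qb in ∈-mapMaybe⁺ f (P⊆as a Pa) fa≡b

module Observation (G : Graph) (k : ℕ) (S : List (V G)) where

  Observed : ℕ → V G → Set
  Observed = PowerStep G k S

  observed-mono′ : ∀ {i j w} → i ≤′ j → Observed i w → Observed j w
  observed-mono′ ≤′-refl        o = o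
  observed-mono′ (≤′-step i≤′j) o = inj₁ (observed-mono′ i≤′j o)

  observed-mono : ∀ {i j w} → i ≤ j → Observed i w → Observed j w
  observed-mono i≤j = observed-mono′ (≤⇒≤′ i≤j)

  NbhdObserved : ℕ → V G → Set
  NbhdObserved r x = ∀ y → x ≡ y ⊎ Adj G x y → Observed r y

  -- Once x₁ is observed, x has at most k unobserved neighbours and forces them all.
  nbhdObserved-step : ∀ {r x x₁} → Finite G → DegAtMost G x (suc k) → Adj G x x₁ →
    Observed r x → Observed r x₁ → ¬ ¬ NbhdObserved (suc r) x
  nbhdObserved-step {r} {x} {x₁} fin deg x~x₁ obs-x obs-x₁ = forced <$> ¬¬-decidable-listed fin
    where
    forced : Decidable (Observed r) → NbhdObserved (suc r) x
    forced observed? y (inj₁ refl) = inj₁ obs-x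
    forced observed? y (inj₂ x~y) with observed? y
    ... | yes obs-y = inj₁ obs-y
    ... | no ¬obs-y = inj₂ (x , obs-x , (y , x~y , ¬obs-y) ,
      atMost-filter (¬? ∘ observed?) deg x~x₁ (λ ¬obs → ¬obs obs-x₁) , x~y)

  module _ {X : V G → Bool} (fin : Finite G) (simple : Simple G)
           (deg : ∀ x → X x ≡ true → DegAtMost G x (suc k)) where

    nbhdObserved-along : ∀ {x x₀ r} → Star (λ a b → X a ≡ true × X b ≡ true × Adj G a b) x x₀ →
      NbhdObserved r x₀ → ¬ ¬ Σ ℕ λ r′ → NbhdObserved r′ x
    nbhdObserved-along ε N[x₀] = return (_ , N[x₀])
    nbhdObserved-along ((Xx , _ , x~x₁) ◅ walk) N[x₀] = do
      r , N[x₁] ← nbhdObserved-along walk N[x₀]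
      let x₁~x = proj₁ simple _ _ x~x₁
      N[x] ← nbhdObserved-step fin (deg _ Xx) x~x₁ (N[x₁] _ (inj₂ x₁~x)) (N[x₁] _ (inj₁ refl))
      return (suc r , N[x])

    nbhdObserved-inside : ∀ {x₀} → InducedConnected G X → x₀ ∈ S → X x₀ ≡ true →
      ¬ ¬ Σ ℕ λ R → ∀ x → X x ≡ true → NbhdObserved R x
    nbhdObserved-inside {x₀} (_ , walks) x₀∈S Xx₀ = do
      bounds ← ¬¬-∀-listed fin reach
      return (uniform-bound (λ i≤j N[x] Xx y x≈y → observed-mono i≤j (N[x] Xx y x≈y)) fin bounds)
      where
      N[x₀] : NbhdObserved 0 x₀
      N[x₀] y x₀≈y = x₀ , x₀∈S , x₀≈y
      reach : ∀ x → ¬ ¬ Σ ℕ λ r → X x ≡ true → NbhdObserved r x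
      reach x with X x in Xx
      ... | false = return (0 , λ ())
      ... | true  = do
        r , N[x] ← nbhdObserved-along (walks x x₀ Xx Xx₀) N[x₀]
        return (r , λ _ → N[x])

-- Propagation in G from S is replayed in H from T along embed, delay rounds later.
record Simulation (G H : Graph) (k : ℕ) (S : List (V G)) (T : List (V H)) : Set where
  field
    embed         : V G → Maybe (V H)
    embed-inj     : PartialInjective embed
    embed-adj     : ∀ {u v u′ v′} → embed u ≡ just u′ → embed v ≡ just v′ →
                    Adj G u v ⇔ Adj H u′ v′
    delay         : ℕ
    covered       : ∀ z → (∃ λ w → embed w ≡ just z) ⊎ PowerStep H k T delay z
    initial       : ∀ {w w′} → PowerStep G k S 0 w → embed w ≡ just w′ → PowerStep H k T delay w′
    boundary      : ∀ {v w w′} → embed v ≡ nothing → Adj G v w → embed w ≡ just w′ →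
                    PowerStep H k T delay w′

module _ {G H : Graph} {k : ℕ} {S : List (V G)} {T : List (V H)} (sim : Simulation G H k S T) where
  open Simulation sim
  open Observation G k S using () renaming (Observed to Observedᴳ)
  open Observation H k T using (observed-mono) renaming (Observed to Observedᴴ)

  observed-tracked : ∀ i {w w′} → Observedᴳ i w → embed w ≡ just w′ →
    ¬ ¬ Observedᴴ (i + delay) w′
  observed-tracked zero obs-w e = return (initial obs-w e)
  observed-tracked (suc i) (inj₁ obs-w) e = inj₁ <$> observed-tracked i obs-w e
  observed-tracked (suc i) {w} {w′} (inj₂ (v , obs-v , _ , few , v~w)) e with embed v in ev
  ... | nothing = return (observed-mono (m≤n+m delay (suc i)) (boundary ev v~w e))
  ... | just v′ = do
    obs-v′ ← observed-tracked i obs-v ev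
    now? ← ¬¬-excluded-middle
    return (forced obs-v′ now?)
    where
    v′~w′ : Adj H v′ w′
    v′~w′ = Equivalence.to (embed-adj ev e) v~w
    few′ : AtMost k (λ z → Adj H v′ z × ¬ Observedᴴ (i + delay) z)
    few′ = atMost-mapMaybe embed-inj few preimage
      where
      preimage : ∀ z → Adj H v′ z × ¬ Observedᴴ (i + delay) z →
        ∃ λ u → (Adj G v u × ¬ Observedᴳ i u) × embed u ≡ just z
      preimage z (v′~z , ¬obs-z) with covered z
      ... | inj₁ (u , eu) =
        u , (Equivalence.from (embed-adj ev eu) v′~z ,
             λ obs-u → observed-tracked i obs-u eu ¬obs-z) , eu
      ... | inj₂ obs-z = ⊥-elim (¬obs-z (observed-mono (m≤n+m delay i) obs-z))
    forced : Observedᴴ (i + delay) v′ → Dec (Observedᴴ (i + delay) w′) →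
      Observedᴴ (suc i + delay) w′
    forced _      (yes obs-w′) = inj₁ obs-w′
    forced obs-v′ (no ¬obs-w′) = inj₂ (v′ , obs-v′ , (w′ , v′~w′ , ¬obs-w′) , few′ , v′~w′)

  simulation-kpds : Finite H → IsKPDS G k S → ¬ ¬ IsKPDS H k T
  simulation-kpds fin (ℓ , all-observed) = do
    all-observed′ ← ¬¬-∀-listed fin observed
    return (ℓ + delay , all-observed′)
    where
    observed : ∀ z → ¬ ¬ Observedᴴ (ℓ + delay) z
    observed z with covered z
    ... | inj₁ (w , e) = observed-tracked ℓ (all-observed w) e
    ... | inj₂ obs-z = return (observed-mono (m≤n+m delay ℓ) obs-z)

powerDomNumber-≤-suc : ∀ {G H k m m′} → IsPowerDomNumber G k m → IsPowerDomNumber H k m′ →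
  (∀ S → Unique S → IsKPDS G k S →
     ¬ ¬ Σ (List (V H)) λ T → Unique T × IsKPDS H k T × length T ≤ length S + 1) →
  m′ ≤ m + 1
powerDomNumber-≤-suc ((S , S-unique , S-kpds , refl) , _) (_ , minimal) transfer =
  decidable-stable (_ ≤? _) (do
    T , T-unique , T-kpds , |T|≤ ← transfer S S-unique S-kpds
    return (≤-trans (minimal T T-unique T-kpds) |T|≤))

module Contraction (G : Graph) (X : V G → Bool) where

  private module Bool-UIP = Decidable⇒UIP _≟_

  contract : V G → Maybe (V (G / X))
  contract w with X w ≟ false
  ... | yes Xw = just (inj₁ (w , Xw))
  ... | no _   = nothing

  contract-just⁻ : ∀ {w z} → contract w ≡ just z → ∃ λ Xw → z ≡ inj₁ (w , Xw)
  contract-just⁻ {w} e with X w ≟ false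
  contract-just⁻ refl | yes Xw = Xw , refl

  contract-just⁺ : ∀ {w} (Xw : X w ≡ false) → contract w ≡ just (inj₁ (w , Xw))
  contract-just⁺ {w} Xw with X w ≟ false
  ... | yes Xw′ = cong (λ p → just (inj₁ (w , p))) (Bool-UIP.≡-irrelevant Xw′ Xw)
  ... | no ¬Xw  = ⊥-elim (¬Xw Xw)

  contract-nothing⁻ : ∀ {w} → contract w ≡ nothing → X w ≡ true
  contract-nothing⁻ {w} e with X w ≟ false
  ... | no ¬Xw = ¬-not ¬Xw

  contract-inj : PartialInjective contract
  contract-inj e e′ with contract-just⁻ e | contract-just⁻ e′
  ... | _ , refl | _ , refl = refl

  contract-adj : ∀ {u v u′ v′} → contract u ≡ just u′ → contract v ≡ just v′ →
    Adj G u v ⇔ Adj (G / X) u′ v′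
  contract-adj eu ev with contract-just⁻ eu | contract-just⁻ ev
  ... | _ , refl | _ , refl = mk⇔ id id

  uncontract : V (G / X) → Maybe (V G)
  uncontract (inj₁ (w , _)) = just w
  uncontract (inj₂ _)       = nothing

  uncontract-inj : PartialInjective uncontract
  uncontract-inj {inj₁ (w , Xw)} {inj₁ (_ , Xw′)} refl refl =
    cong (λ p → inj₁ (w , p)) (Bool-UIP.≡-irrelevant Xw Xw′)

  uncontract-adj : ∀ {u v u′ v′} → uncontract u ≡ just u′ → uncontract v ≡ just v′ →
    Adj (G / X) u v ⇔ Adj G u′ v′
  uncontract-adj {inj₁ _} {inj₁ _} refl refl = mk⇔ id id

  contraction-finite : Finite G → Finite (G / X)
  contraction-finite (vs , ∈vs) = inj₂ tt ∷ mapMaybe contract vs , λ where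
    (inj₁ (w , Xw)) → there (∈-mapMaybe⁺ contract (∈vs w) (contract-just⁺ Xw))
    (inj₂ tt)       → here refl

  module _ (k : ℕ) where

    contracted-observes : ∀ {T x w w′} → X x ≡ true → Adj G x w → contract w ≡ just w′ →
      PowerStep (G / X) k (inj₂ tt ∷ T) 0 w′
    contracted-observes Xx x~w e with contract-just⁻ e
    ... | _ , refl = inj₂ tt , here refl , inj₂ (_ , Xx , x~w)

    contract-simulation : ∀ S → Simulation G (G / X) k S (inj₂ tt ∷ mapMaybe contract S)
    contract-simulation S = record
      { embed     = contract
      ; embed-inj = contract-inj
      ; embed-adj = contract-adj
      ; delay     = 0
      ; covered   = covered
      ; initial   = initial
      ; boundary  = λ ev → contracted-observes (contract-nothing⁻ ev)
      }
      where
      T = inj₂ tt ∷ mapMaybe contract S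
      covered : ∀ z → (∃ λ w → contract w ≡ just z) ⊎ PowerStep (G / X) k T 0 z
      covered (inj₁ (w , Xw)) = inj₁ (w , contract-just⁺ Xw)
      covered (inj₂ tt)       = inj₂ (inj₂ tt , here refl , inj₁ refl)
      initial : ∀ {w w′} → PowerStep G k S 0 w → contract w ≡ just w′ → PowerStep (G / X) k T 0 w′
      initial (s , s∈S , inj₁ refl) e = _ , there (∈-mapMaybe⁺ contract s∈S e) , inj₁ refl
      initial (s , s∈S , inj₂ s~w) e with contract s in es
      ... | just s′ =
        s′ , there (∈-mapMaybe⁺ contract s∈S es) , inj₂ (Equivalence.to (contract-adj es e) s~w)
      ... | nothing = contracted-observes (contract-nothing⁻ es) s~w e

    contraction-transfer : Finite G → ∀ S → Unique S → IsKPDS G k S →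
      ¬ ¬ Σ (List (V (G / X))) λ T → Unique T × IsKPDS (G / X) k T × length T ≤ length S + 1
    contraction-transfer fin S S-unique S-kpds = do
      T-kpds ← simulation-kpds (contract-simulation S) (contraction-finite fin) S-kpds
      return (_ , ∷-mapMaybe-unique contract contract-inj vX∉ S-unique , T-kpds ,
              length-∷-mapMaybe contract (inj₂ tt) S)
      where
      vX∉ : ∀ w → contract w ≢ just (inj₂ tt)
      vX∉ w e with () ← proj₂ (contract-just⁻ e)

    uncontract-simulation : ∀ {S′ x₀ R} →
      (∀ x → X x ≡ true → Observation.NbhdObserved G k (x₀ ∷ mapMaybe uncontract S′) R x) →
      Simulation (G / X) G k S′ (x₀ ∷ mapMaybe uncontract S′)
    uncontract-simulation {S′} {x₀} {R} N[X] = record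
      { embed     = uncontract
      ; embed-inj = uncontract-inj
      ; embed-adj = uncontract-adj
      ; delay     = R
      ; covered   = covered
      ; initial   = initial
      ; boundary  = boundary
      }
      where
      T = x₀ ∷ mapMaybe uncontract S′
      open Observation G k T using (observed-mono)
      covered : ∀ w → (∃ λ z → uncontract z ≡ just w) ⊎ PowerStep G k T R w
      covered w with X w ≟ false
      ... | yes Xw = inj₁ (inj₁ (w , Xw) , refl)
      ... | no ¬Xw = inj₂ (N[X] w (¬-not ¬Xw) w (inj₁ refl))
      initial : ∀ {z w} → PowerStep (G / X) k S′ 0 z → uncontract z ≡ just w → PowerStep G k T R w
      initial (inj₁ (s , _) , s∈S′ , inj₁ refl) refl =
        observed-mono z≤n (s , there (∈-mapMaybe⁺ uncontract s∈S′ refl) , inj₁ refl)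
      initial {inj₁ _} (inj₁ (s , _) , s∈S′ , inj₂ s~w) refl =
        observed-mono z≤n (s , there (∈-mapMaybe⁺ uncontract s∈S′ refl) , inj₂ s~w)
      initial {inj₁ _} (inj₂ tt , _ , inj₂ (x , Xx , x~w)) refl = N[X] x Xx _ (inj₂ x~w)
      boundary : ∀ {v z w} → uncontract v ≡ nothing → Adj (G / X) v z → uncontract z ≡ just w →
        PowerStep G k T R w
      boundary {inj₂ tt} {inj₁ _} _ (x , Xx , x~w) refl = N[X] x Xx _ (inj₂ x~w)

    uncontraction-transfer : Finite G → Simple G → InducedConnected G X →
      (∀ x → X x ≡ true → DegAtMost G x (suc k)) → ∀ S′ → Unique S′ → IsKPDS (G / X) k S′ →
      ¬ ¬ Σ (List (V G)) λ T → Unique T × IsKPDS G k T × length T ≤ length S′ + 1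
    uncontraction-transfer fin simple connected deg S′ S′-unique S′-kpds = do
      R , N[X] ← Observation.nbhdObserved-inside G k T fin simple deg connected (here refl) Xx₀
      T-kpds ← simulation-kpds (uncontract-simulation N[X]) fin S′-kpds
      return (T , ∷-mapMaybe-unique uncontract uncontract-inj x₀∉ S′-unique , T-kpds ,
              length-∷-mapMaybe uncontract x₀ S′)
      where
      x₀  = proj₁ (proj₁ connected)
      Xx₀ = proj₂ (proj₁ connected)
      T = x₀ ∷ mapMaybe uncontract S′
      x₀∉ : ∀ z → uncontract z ≢ just x₀
      x₀∉ (inj₁ (_ , Xx₀′)) refl with () ← trans (sym Xx₀) Xx₀′

corollary4p7 : (k : ℕ) (G : Graph) → Finite G → Simple G → Connected G →
    (X : V G → Bool) → InducedConnected G X →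
    (∀ x → X x ≡ true → DegAtMost G x (suc k)) →
    (m m' : ℕ) → IsPowerDomNumber G k m → IsPowerDomNumber (G / X) k m' →
    (m' ≤ m + 1) × (m ≤ m' + 1)
corollary4p7 k G fin simple _ X connected deg m m′ γ γ′ =
  powerDomNumber-≤-suc γ γ′ (contraction-transfer k fin) ,
  powerDomNumber-≤-suc γ′ γ (uncontraction-transfer k fin simple connected deg)
  where open Contraction G X
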